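{- Let $X$ be a finite set with $|X|\geq 2$. If an undirected binary phylogenetic network $N=(V,E)$ on $X$ is tree-child orientable, then $|E|\leq 5|X|-6$. Moreover, this upper bound is tight: there exist a finite set $X$ and a tree-child orientable undirected binary phylogenetic network $N=(V,E)$ on $X$ with $|E|=5|X|-6$.
   Context: All graphs are finite, simple and connected. An undirected binary phylogenetic network on $X$ is a connected simple undirected graph $N$ such that $X$ is exactly the set of degree-$1$ vertices (the leaves) and every non-leaf vertex has degree $3$. A directed binary phylogenetic network on $X$ is a finite simple weakly connected acyclic directed graph such that: $X$ is exactly the set of vertices with (in-degree, out-degree) $=(1,0)$ (the leaves); there is a unique vertex $\rho$ (the root) with (in-degree, out-degree) $=(0,2)$; every other vertex has (in-degree, out-degree) $\in\{(1,2),(2,1)\}$. Vertices of in-degree $2$ are reticulations; non-leaf vertices of in-degree $1$ are tree vertices. It is a tree-child network if every non-leaf vertex has at least one child that is a tree vertex or a leaf. An orientation of an undirected binary phylogenetic network $N$ is obtained by choosing an edge $e_\rho$ of $N$, subdividing it by a new vertex $\rho$, and assigning a direction to every edge of the resulting graph so that the result is a directed binary phylogenetic network on $X$ with root $\rho$. $N$ is tree-child orientable if it has an orientation that is a tree-child network. -}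

module Defs where

open import Data.Nat using (ℕ; zero; suc; _+_; _≡ᵇ_; _<ᵇ_)
open import Data.Fin using (Fin; zero; suc; toℕ; _≟_)
open import Data.Bool using (Bool; true; false; if_then_else_; _∧_; _∨_; not)
open import Data.Product using (Σ; _×_; ∃; _,_)
open import Data.Sum using (_⊎_)
open import Relation.Nullary using (¬_)
open import Relation.Nullary.Decidable using (⌊_⌋)
open import Relation.Binary.PropositionalEquality using (_≡_)
open import Function using (_∘_; _⇔_)

sumF : ∀ {n} → (Fin n → ℕ) → ℕ
sumF {zero}  f = 0
sumF {suc n} f = f zero + sumF (f ∘ suc)

count : ∀ {n} → (Fin n → Bool) → ℕ
count f = sumF (λ i → if f i then 1 else 0)

data Reach {n} (R : Fin n → Fin n → Bool) : Fin n → Fin n → Set where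
  here : ∀ {u} → Reach R u u
  step : ∀ {u v w} → R u v ≡ true → Reach R v w → Reach R u w

data Reach⁺ {n} (R : Fin n → Fin n → Bool) : Fin n → Fin n → Set where
  one  : ∀ {u v} → R u v ≡ true → Reach⁺ R u v
  more : ∀ {u v w} → R u v ≡ true → Reach⁺ R v w → Reach⁺ R u w

record UGraph (n : ℕ) : Set where
  field
    adj    : Fin n → Fin n → Bool
    sym    : ∀ u v → adj u v ≡ adj v u
    irrefl : ∀ u → adj u u ≡ false
open UGraph public

deg : ∀ {n} → UGraph n → Fin n → ℕ
deg G v = count (adj G v)

Connected : ∀ {n} → UGraph n → Set
Connected G = ∀ u v → Reach (adj G) u v

edgeCount : ∀ {n} → UGraph n → ℕ
edgeCount G = sumF (λ i → count (λ j → adj G i j ∧ (toℕ i <ᵇ toℕ j)))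

ULeaf : ∀ {n} → UGraph n → Fin n → Set
ULeaf G v = deg G v ≡ 1

-- |X| = number of leaves
numLeaves : ∀ {n} → UGraph n → ℕ
numLeaves G = count (λ v → deg G v ≡ᵇ 1)

IsUBinNet : ∀ {n} → UGraph n → Set
IsUBinNet G = Connected G × (∀ v → deg G v ≡ 1 ⊎ deg G v ≡ 3)

module _ {m : ℕ} (arc : Fin m → Fin m → Bool) where

  indeg : Fin m → ℕ
  indeg v = count (λ u → arc u v)

  outdeg : Fin m → ℕ
  outdeg v = count (arc v)

  DLeaf : Fin m → Set
  DLeaf v = indeg v ≡ 1 × outdeg v ≡ 0

  Reticulation : Fin m → Set
  Reticulation v = indeg v ≡ 2

  TreeVertex : Fin m → Set
  TreeVertex v = indeg v ≡ 1 × ¬ DLeaf v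

  Acyclic : Set
  Acyclic = ∀ v → ¬ Reach⁺ arc v v

  SimpleDigraph : Set
  SimpleDigraph = ∀ v → arc v v ≡ false

  WeaklyConnected : Set
  WeaklyConnected = ∀ u v → Reach (λ x y → arc x y ∨ arc y x) u v

  -- directed binary phylogenetic network with root ρ
  -- (uniqueness of the root follows from the last clause)
  IsDBinNet : Fin m → Set
  IsDBinNet ρ =
    SimpleDigraph × WeaklyConnected × Acyclic ×
    (indeg ρ ≡ 0 × outdeg ρ ≡ 2) ×
    (∀ v → ¬ v ≡ ρ →
      (indeg v ≡ 1 × outdeg v ≡ 0) ⊎ (indeg v ≡ 1 × outdeg v ≡ 2) ⊎
      (indeg v ≡ 2 × outdeg v ≡ 1))

  TreeChild : Set
  TreeChild = ∀ v → ¬ DLeaf v →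
    Σ (Fin m) (λ c → arc v c ≡ true × (TreeVertex c ⊎ DLeaf c))

-- Subdividing the edge {a,b} of G by a new vertex ρ = zero;
-- an original vertex v becomes suc v.

eqᵇ : ∀ {n} → Fin n → Fin n → Bool
eqᵇ i j = ⌊ i ≟ j ⌋

subdivAdj : ∀ {n} → UGraph n → Fin n → Fin n →
            Fin (suc n) → Fin (suc n) → Bool
subdivAdj G a b zero    zero    = false
subdivAdj G a b zero    (suc j) = eqᵇ j a ∨ eqᵇ j b
subdivAdj G a b (suc i) zero    = eqᵇ i a ∨ eqᵇ i b
subdivAdj G a b (suc i) (suc j) =
  adj G i j ∧ not ((eqᵇ i a ∧ eqᵇ j b) ∨ (eqᵇ i b ∧ eqᵇ j a))

IsDirectionOf : ∀ {n} → (Fin (suc n) → Fin (suc n) → Bool) →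
                (Fin (suc n) → Fin (suc n) → Bool) → Set
IsDirectionOf arc S =
  (∀ x y → (arc x y ≡ true ⊎ arc y x ≡ true) ⇔ S x y ≡ true) ×
  (∀ x y → arc x y ≡ true → arc y x ≡ false)

IsOrientation : ∀ {n} → UGraph n → Fin n → Fin n →
                (Fin (suc n) → Fin (suc n) → Bool) → Set
IsOrientation G a b arc =
  adj G a b ≡ true ×
  IsDirectionOf arc (subdivAdj G a b) ×
  IsDBinNet arc zero ×
  (¬ DLeaf arc zero) × (∀ v → DLeaf arc (suc v) ⇔ ULeaf G v)

TreeChildOrientable : ∀ {n} → UGraph n → Set
TreeChildOrientable {n} G =
  Σ (Fin n) λ a → Σ (Fin n) λ b →
  Σ (Fin (suc n) → Fin (suc n) → Bool) λ arc →
    IsOrientation G a b arc × TreeChild arc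

module Submission where

-- Orient the network and let L, T, R be the numbers of leaves, tree vertices
-- and reticulations below the root. Counting arcs at their heads and at their
-- tails gives L + T + 2R = 2 + 2T + R, i.e. L + R = T + 2. In a tree-child
-- network every non-leaf vertex (the root, the T tree vertices and the R
-- reticulations) has a child of in-degree one, and such a child has only one
-- parent, so 1 + T + R ≤ L + T, i.e. R ≤ L − 1. The handshake lemma in the
-- undirected network gives 2|E| = L + 3(T + R) = 4L + 6R − 6 ≤ 10L − 12.
-- Equality holds for a network with 3 leaves and 2 reticulations.

open import Data.Bool using (Bool; true; false; if_then_else_; _∧_; _∨_)
open import Data.Bool.ListAction using (any)
open import Data.Bool.Properties using (∨-comm) renaming (_≟_ to _≟ᵇ_)
open import Data.Empty using (⊥-elim)
open import Data.Fin as Fin using (Fin; zero; suc; toℕ)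
open import Data.Fin.Induction using (<-wellFounded)
open import Data.Fin.Patterns using (0F; 2F)
open import Data.Fin.Properties using (toℕ-injective; all?; any?) renaming (_≟_ to _≟ᶠ_)
open import Data.List using (List; []; _∷_)
open import Data.Nat using (ℕ; zero; suc; _+_; _*_; _<_; _≤_; _<ᵇ_; _≡ᵇ_; z≤n; s≤s)
open import Data.Nat.Properties
  using ( _≟_; _<?_; +-*-semiring; ≤-trans; ≤-reflexive; <-trans; <-irrefl; m≤m+n; m≤n+m; 0≢1+n
        ; +-mono-≤; +-monoʳ-≤; *-monoʳ-≤; +-cancelʳ-≡; +-cancelʳ-≤; *-cancelˡ-≤; module ≤-Reasoning)
open import Algebra.Properties.Semiring.Sum +-*-semiring
  using (sum; sum-cong-≗; ∑-distrib-+; ∑-comm; *-distribˡ-sum)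
open import Data.Nat.Tactic.RingSolver using (solve; solve-∀)
open import Data.Product using (Σ; ∃; _×_; _,_; proj₁; proj₂)
open import Data.Sum using (_⊎_; inj₁; inj₂)
open import Defs hiding (sym)
open import Function using (_∘_; _⇔_; mk⇔; Equivalence)
open import Induction.WellFounded using (Acc; acc)
open import Relation.Binary.PropositionalEquality
open import Relation.Nullary using (¬_; Dec)
open import Relation.Nullary.Decidable using (from-yes; map′; ¬?; _×-dec_; _⊎-dec_; _→-dec_)

𝟙 : Bool → ℕ
𝟙 b = if b then 1 else 0

sumF≡sum : ∀ {n} (f : Fin n → ℕ) → sumF f ≡ sum f
sumF≡sum {zero}  f = refl
sumF≡sum {suc n} f = cong (f zero +_) (sumF≡sum (f ∘ suc))

sum-mono-≤ : ∀ {n} {f g : Fin n → ℕ} → (∀ i → f i ≤ g i) → sum f ≤ sum g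
sum-mono-≤ {zero}  f≤g = z≤n
sum-mono-≤ {suc n} f≤g = +-mono-≤ (f≤g zero) (sum-mono-≤ (f≤g ∘ suc))

term≤sum : ∀ {n} (f : Fin n → ℕ) i → f i ≤ sum f
term≤sum f zero    = m≤m+n _ _
term≤sum f (suc i) = ≤-trans (term≤sum (f ∘ suc) i) (m≤n+m _ _)

𝟙[x<y]+𝟙[y<x]≡1 : ∀ x y → ¬ x ≡ y → 𝟙 (x <ᵇ y) + 𝟙 (y <ᵇ x) ≡ 1
𝟙[x<y]+𝟙[y<x]≡1 zero    zero    x≢y = ⊥-elim (x≢y refl)
𝟙[x<y]+𝟙[y<x]≡1 zero    (suc y) x≢y = refl
𝟙[x<y]+𝟙[y<x]≡1 (suc x) zero    x≢y = refl
𝟙[x<y]+𝟙[y<x]≡1 (suc x) (suc y) x≢y = 𝟙[x<y]+𝟙[y<x]≡1 x y (x≢y ∘ cong suc)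

𝟙[≡1]-absorbs : ∀ d → 𝟙 (d ≡ᵇ 1) * d ≡ 𝟙 (d ≡ᵇ 1)
𝟙[≡1]-absorbs zero          = refl
𝟙[≡1]-absorbs (suc zero)    = refl
𝟙[≡1]-absorbs (suc (suc d)) = refl

module _ {n} (G : UGraph n) where

  private
    oriented : Fin n → Fin n → ℕ
    oriented i j = 𝟙 (adj G i j ∧ (toℕ i <ᵇ toℕ j))

  𝟙-adj-split : ∀ i j → 𝟙 (adj G i j) ≡ oriented i j + oriented j i
  𝟙-adj-split i j rewrite UGraph.sym G j i with adj G i j in i~j
  ... | false = refl
  ... | true  = sym (𝟙[x<y]+𝟙[y<x]≡1 (toℕ i) (toℕ j) (i≢j ∘ toℕ-injective))
    where
    i≢j : ¬ i ≡ j
    i≢j refl with () ← trans (sym i~j) (irrefl G i)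

  handshake : sum (deg G) ≡ edgeCount G + edgeCount G
  handshake = begin
    sum (deg G)
      ≡⟨ sum-cong-≗ (λ i → sumF≡sum (𝟙 ∘ adj G i)) ⟩
    sum (λ i → sum (λ j → 𝟙 (adj G i j)))
      ≡⟨ sum-cong-≗ (λ i → sum-cong-≗ (𝟙-adj-split i)) ⟩
    sum (λ i → sum (λ j → oriented i j + oriented j i))
      ≡⟨ sum-cong-≗ (λ i → ∑-distrib-+ (oriented i) (λ j → oriented j i)) ⟩
    sum (λ i → sum (oriented i) + sum (λ j → oriented j i))
      ≡⟨ ∑-distrib-+ (λ i → sum (oriented i)) (λ i → sum (λ j → oriented j i)) ⟩
    sum (λ i → sum (oriented i)) + sum (λ i → sum (λ j → oriented j i))
      ≡⟨ cong (sum (λ i → sum (oriented i)) +_) (∑-comm (λ i j → oriented j i)) ⟩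
    sum (λ i → sum (oriented i)) + sum (λ j → sum (oriented j))
      ≡⟨ cong₂ _+_ edgeCount≡ edgeCount≡ ⟨
    edgeCount G + edgeCount G
      ∎
    where
    open ≡-Reasoning
    edgeCount≡ : edgeCount G ≡ sum (λ i → sum (oriented i))
    edgeCount≡ = trans (sumF≡sum (λ i → sumF (oriented i))) (sum-cong-≗ (λ i → sumF≡sum (oriented i)))

module _ {m} (arc : Fin m → Fin m → Bool) where

  private
    arcs-into : Fin m → Fin m → ℕ
    arcs-into v u = 𝟙 (arc u v)

  sum-indeg≡sum-outdeg : sum (indeg arc) ≡ sum (outdeg arc)
  sum-indeg≡sum-outdeg = begin
    sum (indeg arc)                      ≡⟨ sum-cong-≗ (λ v → sumF≡sum (arcs-into v)) ⟩
    sum (λ v → sum (λ u → 𝟙 (arc u v)))  ≡⟨ ∑-comm arcs-into ⟩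
    sum (λ u → sum (λ v → 𝟙 (arc u v)))  ≡⟨ sum-cong-≗ (λ u → sumF≡sum (𝟙 ∘ arc u)) ⟨
    sum (outdeg arc)                     ∎
    where open ≡-Reasoning

  -- Give each vertex with a child a child of in-degree one; the vertex is
  -- that child's only parent, so no child is chosen twice.
  treeChild-count : TreeChild arc →
    sum (λ u → 𝟙 (0 <ᵇ outdeg arc u)) ≤ sum (λ c → 𝟙 (indeg arc c ≡ᵇ 1))
  treeChild-count tc = begin
    sum (λ u → 𝟙 (0 <ᵇ outdeg arc u))
      ≤⟨ sum-mono-≤ has-child-of-indeg-1 ⟩
    sum (λ u → sum (λ c → weight c * 𝟙 (arc u c)))
      ≡⟨ ∑-comm (λ u c → weight c * 𝟙 (arc u c)) ⟩
    sum (λ c → sum (λ u → weight c * 𝟙 (arc u c)))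
      ≡⟨ sum-cong-≗ (λ c → *-distribˡ-sum (weight c) (arcs-into c)) ⟨
    sum (λ c → weight c * sum (arcs-into c))
      ≡⟨ sum-cong-≗ (λ c → cong (weight c *_) (sumF≡sum (arcs-into c))) ⟨
    sum (λ c → weight c * indeg arc c)
      ≡⟨ sum-cong-≗ (λ c → 𝟙[≡1]-absorbs (indeg arc c)) ⟩
    sum weight
      ∎
    where
    open ≤-Reasoning
    weight : Fin m → ℕ
    weight c = 𝟙 (indeg arc c ≡ᵇ 1)
    indeg≡1 : ∀ {c} → TreeVertex arc c ⊎ DLeaf arc c → indeg arc c ≡ 1
    indeg≡1 (inj₁ (in≡1 , _)) = in≡1
    indeg≡1 (inj₂ (in≡1 , _)) = in≡1
    has-child-of-indeg-1 : ∀ u → 𝟙 (0 <ᵇ outdeg arc u) ≤ sum (λ c → weight c * 𝟙 (arc u c))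
    has-child-of-indeg-1 u with outdeg arc u in out-u
    ... | zero  = z≤n
    ... | suc _ with tc u (λ (_ , out≡0) → 0≢1+n (trans (sym out≡0) out-u))
    ...   | c , u→c , child =
      ≤-trans (≤-reflexive (sym (cong₂ (λ d b → 𝟙 (d ≡ᵇ 1) * 𝟙 b) (indeg≡1 child) u→c)))
              (term≤sum (λ c → weight c * 𝟙 (arc u c)) c)

data Kind : Set where
  leaf tree reticulation : Kind

kindIndeg kindOutdeg kindDeg : Kind → ℕ
kindIndeg leaf         = 1
kindIndeg tree         = 1
kindIndeg reticulation = 2
kindOutdeg leaf         = 0
kindOutdeg tree         = 2
kindOutdeg reticulation = 1
kindDeg leaf = 1
kindDeg _    = 3

BinaryDegrees : ℕ → ℕ → Set
BinaryDegrees i o = (i ≡ 1 × o ≡ 0) ⊎ (i ≡ 1 × o ≡ 2) ⊎ (i ≡ 2 × o ≡ 1)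

classify : ∀ {i o} → BinaryDegrees i o → Σ Kind λ k → i ≡ kindIndeg k × o ≡ kindOutdeg k
classify (inj₁ (refl , refl))        = leaf , refl , refl
classify (inj₂ (inj₁ (refl , refl))) = tree , refl , refl
classify (inj₂ (inj₂ (refl , refl))) = reticulation , refl , refl

δ : Kind → Kind → ℕ
δ leaf         leaf         = 1
δ tree         tree         = 1
δ reticulation reticulation = 1
δ _            _            = 0

census : ∀ {n} → (Fin n → Kind) → Kind → ℕ
census κ k = sum (λ v → δ k (κ v))

infix 7 _·_
_·_ : (Kind → ℕ) → (Kind → ℕ) → ℕ
f · N = f leaf * N leaf + f tree * N tree + f reticulation * N reticulation

sum-by-kind : ∀ {n} (κ : Fin n → Kind) (f : Kind → ℕ) → sum (f ∘ κ) ≡ f · census κ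
sum-by-kind {n} κ f = begin
  sum (f ∘ κ)
    ≡⟨ sum-cong-≗ (decompose ∘ κ) ⟩
  sum (λ v → weighted leaf v + weighted tree v + weighted reticulation v)
    ≡⟨ ∑-distrib-+ (λ v → weighted leaf v + weighted tree v) (weighted reticulation) ⟩
  sum (λ v → weighted leaf v + weighted tree v) + sum (weighted reticulation)
    ≡⟨ cong (_+ sum (weighted reticulation)) (∑-distrib-+ (weighted leaf) (weighted tree)) ⟩
  sum (weighted leaf) + sum (weighted tree) + sum (weighted reticulation)
    ≡⟨ cong₂ _+_ (cong₂ _+_ (pull leaf) (pull tree)) (pull reticulation) ⟨
  f · census κ
    ∎
  where
  open ≡-Reasoning
  weighted : Kind → Fin n → ℕ
  weighted k v = f k * δ k (κ v)
  pull : ∀ k → f k * census κ k ≡ sum (weighted k)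
  pull k = *-distribˡ-sum (f k) (λ v → δ k (κ v))
  select₁ : ∀ a b c → a ≡ a * 1 + b * 0 + c * 0
  select₁ = solve-∀
  select₂ : ∀ a b c → b ≡ a * 0 + b * 1 + c * 0
  select₂ = solve-∀
  select₃ : ∀ a b c → c ≡ a * 0 + b * 0 + c * 1
  select₃ = solve-∀
  decompose : ∀ k → f k ≡ f leaf * δ leaf k + f tree * δ tree k + f reticulation * δ reticulation k
  decompose leaf         = select₁ (f leaf) (f tree) (f reticulation)
  decompose tree         = select₂ (f leaf) (f tree) (f reticulation)
  decompose reticulation = select₃ (f leaf) (f tree) (f reticulation)

deg≡kindDeg : ∀ {d i o} k → i ≡ kindIndeg k → o ≡ kindOutdeg k →
              d ≡ 1 ⊎ d ≡ 3 → (i ≡ 1 × o ≡ 0) ⇔ d ≡ 1 → d ≡ kindDeg k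
deg≡kindDeg leaf refl refl _ leaf⇔ = Equivalence.to leaf⇔ (refl , refl)
deg≡kindDeg tree refl refl (inj₁ d≡1) leaf⇔
  with () ← proj₂ (Equivalence.from leaf⇔ d≡1)
deg≡kindDeg tree refl refl (inj₂ d≡3) _ = d≡3
deg≡kindDeg reticulation refl refl (inj₁ d≡1) leaf⇔
  with () ← proj₁ (Equivalence.from leaf⇔ d≡1)
deg≡kindDeg reticulation refl refl (inj₂ d≡3) _ = d≡3

-- L, T, R count leaves, tree vertices and reticulations; the coefficients are
-- left exactly as _·_ produces them from the kinds.
edge-bound : ∀ L T R E →
  1 * L + 1 * T + 2 * R ≡ 2 + (0 * L + 2 * T + 1 * R) →
  1 + (0 * L + 1 * T + 1 * R) ≤ 1 * L + 1 * T + 0 * R →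
  E + E ≡ 1 * L + 3 * T + 3 * R →
  E + 6 ≤ 5 * (1 * L + 0 * T + 0 * R)
edge-bound L T R E in≡out treeChild handshake = *-cancelˡ-≤ 2 (begin
  2 * (E + 6)                 ≡⟨ solve (E ∷ []) ⟩
  E + E + 12                  ≡⟨ cong (_+ 12) handshake ⟩
  1 * L + 3 * T + 3 * R + 12  ≡⟨ solve (L ∷ T ∷ R ∷ []) ⟩
  L + 3 * (T + 2) + 3 * R + 6 ≡⟨ cong (λ x → L + 3 * x + 3 * R + 6) balance ⟨
  L + 3 * (L + R) + 3 * R + 6 ≡⟨ solve (L ∷ R ∷ []) ⟩
  4 * L + 6 * (1 + R)         ≤⟨ +-monoʳ-≤ (4 * L) (*-monoʳ-≤ 6 R<L) ⟩
  4 * L + 6 * L               ≡⟨ solve (L ∷ []) ⟩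
  2 * (5 * (1 * L + 0 * T + 0 * R)) ∎)
  where
  open ≤-Reasoning
  balance : L + R ≡ T + 2
  balance = +-cancelʳ-≡ (T + R) (L + R) (T + 2) (begin-equality
    L + R + (T + R)             ≡⟨ solve (L ∷ T ∷ R ∷ []) ⟩
    1 * L + 1 * T + 2 * R       ≡⟨ in≡out ⟩
    2 + (0 * L + 2 * T + 1 * R) ≡⟨ solve (L ∷ T ∷ R ∷ []) ⟩
    T + 2 + (T + R)             ∎)
  R<L : 1 + R ≤ L
  R<L = +-cancelʳ-≤ T (1 + R) L (begin
    1 + R + T                   ≡⟨ solve (L ∷ T ∷ R ∷ []) ⟩
    1 + (0 * L + 1 * T + 1 * R) ≤⟨ treeChild ⟩
    1 * L + 1 * T + 0 * R       ≡⟨ solve (L ∷ T ∷ R ∷ []) ⟩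
    L + T                       ∎)

module OrientedNetwork {n} (G : UGraph n) (arc : Fin (suc n) → Fin (suc n) → Bool)
  (root-in : indeg arc zero ≡ 0) (root-out : outdeg arc zero ≡ 2)
  (binary : ∀ v → ¬ v ≡ zero → BinaryDegrees (indeg arc v) (outdeg arc v))
  (cubic : ∀ v → deg G v ≡ 1 ⊎ deg G v ≡ 3)
  (same-leaves : ∀ v → DLeaf arc (suc v) ⇔ ULeaf G v) where

  private
    classified : ∀ v → Σ Kind λ k →
                 indeg arc (suc v) ≡ kindIndeg k × outdeg arc (suc v) ≡ kindOutdeg k
    classified v = classify (binary (suc v) λ ())

  kind : Fin n → Kind
  kind v = proj₁ (classified v)

  sum-over-network : (F : ℕ → ℕ → ℕ) →
    sum (λ u → F (indeg arc u) (outdeg arc u)) ≡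
    F 0 2 + (λ k → F (kindIndeg k) (kindOutdeg k)) · census kind
  sum-over-network F =
    cong₂ _+_ (cong₂ F root-in root-out) (trans (sum-cong-≗ degrees-by-kind) (sum-by-kind kind F-of-kind))
    where
    F-of-kind : Kind → ℕ
    F-of-kind k = F (kindIndeg k) (kindOutdeg k)
    degrees-by-kind : ∀ v → F (indeg arc (suc v)) (outdeg arc (suc v)) ≡ F-of-kind (kind v)
    degrees-by-kind v = cong₂ F (proj₁ (proj₂ (classified v))) (proj₂ (proj₂ (classified v)))

  sum-over-graph : (F : ℕ → ℕ) → sum (λ v → F (deg G v)) ≡ (F ∘ kindDeg) · census kind
  sum-over-graph F = trans (sum-cong-≗ (λ v → cong F (deg-by-kind v))) (sum-by-kind kind (F ∘ kindDeg))
    where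
    deg-by-kind : ∀ v → deg G v ≡ kindDeg (kind v)
    deg-by-kind v with classified v
    ... | k , in≡ , out≡ = deg≡kindDeg k in≡ out≡ (cubic v) (same-leaves v)

  edgeCount-bound : TreeChild arc → edgeCount G + 6 ≤ 5 * numLeaves G
  edgeCount-bound tc = subst (λ x → edgeCount G + 6 ≤ 5 * x) (sym leaf-count)
    (edge-bound (N leaf) (N tree) (N reticulation) (edgeCount G) in≡out nonleaves≤indeg-one edge-sum)
    where
    N : Kind → ℕ
    N = census kind
    in≡out : kindIndeg · N ≡ 2 + kindOutdeg · N
    in≡out = begin
      kindIndeg · N       ≡⟨ sum-over-network (λ i _ → i) ⟨
      sum (indeg arc)     ≡⟨ sum-indeg≡sum-outdeg arc ⟩
      sum (outdeg arc)    ≡⟨ sum-over-network (λ _ o → o) ⟩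
      2 + kindOutdeg · N  ∎
      where open ≡-Reasoning
    nonleaves≤indeg-one : 1 + (λ k → 𝟙 (0 <ᵇ kindOutdeg k)) · N ≤ (λ k → 𝟙 (kindIndeg k ≡ᵇ 1)) · N
    nonleaves≤indeg-one = begin
      1 + (λ k → 𝟙 (0 <ᵇ kindOutdeg k)) · N  ≡⟨ sum-over-network (λ _ o → 𝟙 (0 <ᵇ o)) ⟨
      sum (λ u → 𝟙 (0 <ᵇ outdeg arc u))      ≤⟨ treeChild-count arc tc ⟩
      sum (λ c → 𝟙 (indeg arc c ≡ᵇ 1))       ≡⟨ sum-over-network (λ i _ → 𝟙 (i ≡ᵇ 1)) ⟩
      (λ k → 𝟙 (kindIndeg k ≡ᵇ 1)) · N       ∎
      where open ≤-Reasoning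
    edge-sum : edgeCount G + edgeCount G ≡ kindDeg · N
    edge-sum = trans (sym (handshake G)) (sum-over-graph (λ d → d))
    leaf-count : numLeaves G ≡ (λ k → 𝟙 (kindDeg k ≡ᵇ 1)) · N
    leaf-count = trans (sumF≡sum (λ v → 𝟙 (deg G v ≡ᵇ 1))) (sum-over-graph (λ d → 𝟙 (d ≡ᵇ 1)))

treeChildOrientable⇒edgeCount-bound : ∀ {n} (G : UGraph n) → IsUBinNet G → TreeChildOrientable G →
                                      edgeCount G + 6 ≤ 5 * numLeaves G
treeChildOrientable⇒edgeCount-bound G (_ , cubic)
  (_ , _ , arc , (_ , _ , (_ , _ , _ , (root-in , root-out) , binary) , _ , same-leaves) , tc) =
  OrientedNetwork.edgeCount-bound G arc root-in root-out binary cubic same-leaves tc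

reach-trans : ∀ {n} {R : Fin n → Fin n → Bool} {u v w} → Reach R u v → Reach R v w → Reach R u w
reach-trans here       q = q
reach-trans (step e p) q = step e (reach-trans p q)

reach-reverse : ∀ {n} {R : Fin n → Fin n → Bool} → (∀ x y → R x y ≡ R y x) →
                ∀ {u v} → Reach R u v → Reach R v u
reach-reverse R-sym here               = here
reach-reverse R-sym (step {u} {v} e p) = reach-trans (reach-reverse R-sym p) (step (trans (R-sym v u) e) here)

HasLowerNeighbour : ∀ {n} → (Fin (suc n) → Fin (suc n) → Bool) → Set
HasLowerNeighbour R = ∀ v → ¬ v ≡ zero → ∃ λ u → toℕ u < toℕ v × R v u ≡ true

reach-zero : ∀ {n} {R : Fin (suc n) → Fin (suc n) → Bool} → HasLowerNeighbour R → ∀ v → Reach R v zero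
reach-zero {R = R} lower v = go v (<-wellFounded v)
  where
  go : ∀ v → Acc Fin._<_ v → Reach R v zero
  go zero    _         = here
  go (suc v) (acc rec) with lower (suc v) (λ ())
  ... | u , u<v , v~u = step v~u (go u (rec u<v))

connected-by-lower-neighbours : ∀ {n} {R : Fin (suc n) → Fin (suc n) → Bool} →
  (∀ x y → R x y ≡ R y x) → HasLowerNeighbour R → ∀ u v → Reach R u v
connected-by-lower-neighbours R-sym lower u v =
  reach-trans (reach-zero lower u) (reach-reverse R-sym (reach-zero lower v))

acyclic-by-rank : ∀ {m} {arc : Fin m → Fin m → Bool} (rank : Fin m → ℕ) →
  (∀ x y → arc x y ≡ true → rank x < rank y) → Acyclic arc
acyclic-by-rank {arc = arc} rank increasing v cycle = <-irrefl refl (rank-grows cycle)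
  where
  rank-grows : ∀ {u w} → Reach⁺ arc u w → rank u < rank w
  rank-grows (one e)    = increasing _ _ e
  rank-grows (more e p) = <-trans (increasing _ _ e) (rank-grows p)

_⇔?_ : ∀ {A B : Set} → Dec A → Dec B → Dec (A ⇔ B)
A? ⇔? B? = map′ (λ (to , from) → mk⇔ to from) (λ A⇔B → Equivalence.to A⇔B , Equivalence.from A⇔B)
                ((A? →-dec B?) ×-dec (B? →-dec A?))

lowerNeighbour? : ∀ {n} (R : Fin (suc n) → Fin (suc n) → Bool) → Dec (HasLowerNeighbour R)
lowerNeighbour? R = all? λ v → ¬? (v ≟ᶠ zero) →-dec any? (λ u → (toℕ u <? toℕ v) ×-dec (R v u ≟ᵇ true))

module _ {m} (arc : Fin m → Fin m → Bool) where

  dleaf? : ∀ v → Dec (DLeaf arc v)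
  dleaf? v = (indeg arc v ≟ 1) ×-dec (outdeg arc v ≟ 0)

  treeVertex? : ∀ v → Dec (TreeVertex arc v)
  treeVertex? v = (indeg arc v ≟ 1) ×-dec ¬? (dleaf? v)

  treeChild? : Dec (TreeChild arc)
  treeChild? = all? λ v → ¬? (dleaf? v) →-dec
    any? (λ c → (arc v c ≟ᵇ true) ×-dec (treeVertex? c ⊎-dec dleaf? c))

  binaryDegrees? : ∀ v → Dec (BinaryDegrees (indeg arc v) (outdeg arc v))
  binaryDegrees? v =
    ((indeg arc v ≟ 1) ×-dec (outdeg arc v ≟ 0)) ⊎-dec
    ((indeg arc v ≟ 1) ×-dec (outdeg arc v ≟ 2)) ⊎-dec
    ((indeg arc v ≟ 2) ×-dec (outdeg arc v ≟ 1))

linked : List (ℕ × ℕ) → ℕ → ℕ → Bool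
linked pairs x y = any (λ (p , q) → (x ≡ᵇ p) ∧ (y ≡ᵇ q)) pairs

-- Vertex k of the network is vertex k + 1 of its orientation, whose root 0
-- subdivides the edge {0, 2}. Every arc goes from a smaller to a larger label,
-- so labels rank the orientation and every vertex but 0 has a lower neighbour.
edges : List (ℕ × ℕ)
edges = (0 , 1) ∷ (0 , 2) ∷ (0 , 4) ∷ (1 , 2) ∷ (1 , 5) ∷ (2 , 3) ∷ (3 , 4) ∷ (3 , 6) ∷ (4 , 7) ∷ []

arcs : List (ℕ × ℕ)
arcs = (0 , 1) ∷ (0 , 3) ∷ (1 , 2) ∷ (1 , 5) ∷ (2 , 3) ∷ (2 , 6) ∷ (3 , 4) ∷ (4 , 5) ∷ (4 , 7) ∷ (5 , 8) ∷ []

adjacent : Fin 8 → Fin 8 → Bool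
adjacent i j = linked edges (toℕ i) (toℕ j) ∨ linked edges (toℕ j) (toℕ i)

network : UGraph 8
network = record
  { adj    = adjacent
  ; sym    = λ i j → ∨-comm (linked edges (toℕ i) (toℕ j)) _
  ; irrefl = from-yes (all? λ v → adjacent v v ≟ᵇ false)
  }

orientation : Fin 9 → Fin 9 → Bool
orientation i j = linked arcs (toℕ i) (toℕ j)

network-isUBinNet : IsUBinNet network
network-isUBinNet =
  connected-by-lower-neighbours (UGraph.sym network) (from-yes (lowerNeighbour? adjacent)) ,
  from-yes (all? λ v → (deg network v ≟ 1) ⊎-dec (deg network v ≟ 3))

orientation-isDirection : IsDirectionOf orientation (subdivAdj network 0F 2F)
orientation-isDirection =
  from-yes (all? λ x → all? λ y →
    ((orientation x y ≟ᵇ true) ⊎-dec (orientation y x ≟ᵇ true)) ⇔? (subdivAdj network 0F 2F x y ≟ᵇ true)) ,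
  from-yes (all? λ x → all? λ y → (orientation x y ≟ᵇ true) →-dec (orientation y x ≟ᵇ false))

orientation-isDBinNet : IsDBinNet orientation zero
orientation-isDBinNet =
  from-yes (all? λ v → orientation v v ≟ᵇ false) ,
  connected-by-lower-neighbours (λ x y → ∨-comm (orientation x y) _) (from-yes (lowerNeighbour? underlying)) ,
  acyclic-by-rank toℕ (from-yes (all? λ x → all? λ y → (orientation x y ≟ᵇ true) →-dec (toℕ x <? toℕ y))) ,
  (refl , refl) ,
  from-yes (all? λ v → ¬? (v ≟ᶠ zero) →-dec binaryDegrees? orientation v)
  where
  underlying : Fin 9 → Fin 9 → Bool
  underlying x y = orientation x y ∨ orientation y x

orientation-isOrientation : IsOrientation network 0F 2F orientation
orientation-isOrientation =
  refl , orientation-isDirection , orientation-isDBinNet , (λ ()) ,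
  from-yes (all? λ v → dleaf? orientation (suc v) ⇔? (deg network v ≟ 1))

tight-example : Σ ℕ λ n → Σ (UGraph n) λ G → IsUBinNet G × 2 ≤ numLeaves G ×
                TreeChildOrientable G × edgeCount G + 6 ≡ 5 * numLeaves G
tight-example =
  8 , network , network-isUBinNet , s≤s (s≤s z≤n) ,
  (0F , 2F , orientation , orientation-isOrientation , from-yes (treeChild? orientation)) ,
  refl

-- The bound holds without the hypothesis |X| ≥ 2.
theorem2 : ((n : ℕ) (G : UGraph n) → IsUBinNet G → 2 ≤ numLeaves G →
               TreeChildOrientable G → edgeCount G + 6 ≤ 5 * numLeaves G)
             × Σ ℕ (λ n → Σ (UGraph n) (λ G → IsUBinNet G × 2 ≤ numLeaves G ×
                 TreeChildOrientable G × edgeCount G + 6 ≡ 5 * numLeaves G))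
theorem2 = (λ n G net _ → treeChildOrientable⇒edgeCount-bound G net) , tight-example
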